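{- Let $(A,\to,1)$ be a wBCK*-algebra, and let $*$ be the partial operation on $A$ defined by: $x*y$ is defined if and only if $y\le x$, and then $x*y=x\to y$. Then for all $x,y\in A$, the set $\{z*y : x\le z \text{ and } y\le z\}$ has a greatest element, and $$x\to y=\max\{z*y : x\le z,\ y\le z\}.$$
   Context: A wBCK*-algebra is an algebra $(A,\to,1)$ where $A$ is a poset with order $\le$ and greatest element $1$, $\to$ is a binary operation such that for all $x,y$: $x\le y$ if and only if $x\to y=1$, and for all $x,y,z$: if $x\le y\to z$ then $y\le x\to z$. -}

module Defs where

open import Level using (Level; suc; _⊔_)
open import Data.Product using (Σ; _×_; ∃-syntax)
open import Relation.Binary.PropositionalEquality using (_≡_)
open import Relation.Binary.Structures using (IsPartialOrder)

record WBCKStar (a ℓ : Level) : Set (suc (a ⊔ ℓ)) where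
  infixr 5 _⇒_
  infix 4 _≤_
  field
    Carrier        : Set a
    _≤_            : Carrier → Carrier → Set ℓ
    isPartialOrder : IsPartialOrder _≡_ _≤_
    𝟏              : Carrier
    _⇒_            : Carrier → Carrier → Carrier
    top            : ∀ x → x ≤ 𝟏
    ≤⇔⇒1-to        : ∀ {x y} → x ≤ y → x ⇒ y ≡ 𝟏
    ≤⇔⇒1-from      : ∀ {x y} → x ⇒ y ≡ 𝟏 → x ≤ y
    exchange       : ∀ {x y z} → x ≤ y ⇒ z → y ≤ x ⇒ z

  _*_⟨_⟩ : (x y : Carrier) → y ≤ x → Carrier
  x * y ⟨ _ ⟩ = x ⇒ y

  InS : Carrier → Carrier → Carrier → Set (a ⊔ ℓ)
  InS x y w = ∃[ z ] Σ (x ≤ z) λ _ → Σ (y ≤ z) λ y≤z → w ≡ z * y ⟨ y≤z ⟩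

  IsGreatest : ∀ {p} → (Carrier → Set p) → Carrier → Set (a ⊔ ℓ ⊔ p)
  IsGreatest P m = P m × (∀ w → P w → w ≤ m)

module Submission where

-- In a wBCK*-algebra, "exchange" (x ≤ y ⇒ z implies y ≤ x ⇒ z)
-- yields three basic facts, for all x, y, z:
--   (i)   x ≤ (x ⇒ y) ⇒ y          (exchange applied to x ⇒ y ≤ x ⇒ y),
--   (ii)  y ≤ x ⇒ y                (exchange applied to x ≤ 𝟏 = y ⇒ y),
--   (iii) x ≤ z implies z ⇒ y ≤ x ⇒ y   (⇒ is antitone in its first argument).
-- By (iii) every element z ⇒ y of S(x,y) (with x ≤ z) lies below x ⇒ y, so
-- x ⇒ y is an upper bound of S(x,y). It is also a member: take
-- z = (x ⇒ y) ⇒ y, which lies above x by (i) and above y by (ii); then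
-- z ⇒ y = x ⇒ y by antisymmetry, using (i) for x ⇒ y ≤ z ⇒ y and (i)+(iii)
-- for the converse.

open import Defs
open import Level using (Level)
open import Data.Product using (_×_; ∃-syntax; _,_)
open import Relation.Binary.PropositionalEquality using (_≡_; refl; sym; subst)
open import Relation.Binary.Structures using (IsPartialOrder)

module WBCKStarProperties {a ℓ : Level} (W : WBCKStar a ℓ) where
  open WBCKStar W
  open IsPartialOrder isPartialOrder using (reflexive; trans; antisym)

  ≤-refl : ∀ {x} → x ≤ x
  ≤-refl = reflexive refl

  ≤-double : ∀ x y → x ≤ (x ⇒ y) ⇒ y
  ≤-double x y = exchange ≤-refl

  ⇒-self : ∀ y → y ⇒ y ≡ 𝟏
  ⇒-self y = ≤⇔⇒1-to ≤-refl

  ≤-consequent : ∀ x y → y ≤ x ⇒ y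
  ≤-consequent x y = exchange (subst (x ≤_) (sym (⇒-self y)) (top x))

  ⇒-antitone : ∀ {x z} y → x ≤ z → z ⇒ y ≤ x ⇒ y
  ⇒-antitone y x≤z = exchange (trans x≤z (≤-double _ y))

  ⇒-triple : ∀ x y → ((x ⇒ y) ⇒ y) ⇒ y ≡ x ⇒ y
  ⇒-triple x y = antisym (⇒-antitone y (≤-double x y)) (≤-double (x ⇒ y) y)

  ⇒-∈S : ∀ x y → InS x y (x ⇒ y)
  ⇒-∈S x y = (x ⇒ y) ⇒ y , ≤-double x y , ≤-consequent (x ⇒ y) y
           , sym (⇒-triple x y)

  ⇒-bounds-S : ∀ x y w → InS x y w → w ≤ x ⇒ y
  ⇒-bounds-S x y w (z , x≤z , _ , w≡z⇒y) =
    subst (_≤ x ⇒ y) (sym w≡z⇒y) (⇒-antitone y x≤z)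

  ⇒-greatest-S : ∀ x y → IsGreatest (InS x y) (x ⇒ y)
  ⇒-greatest-S x y = ⇒-∈S x y , ⇒-bounds-S x y

lemma3p3 : ∀ {a ℓ} (W : WBCKStar a ℓ) → let open WBCKStar W in
           ∀ (x y : Carrier) →
           (∃[ m ] IsGreatest (InS x y) m) × IsGreatest (InS x y) (x ⇒ y)
lemma3p3 W x y = (x ⇒ y , greatest) , greatest
  where
  open WBCKStar W using (_⇒_; IsGreatest; InS)
  open WBCKStarProperties W using (⇒-greatest-S)
  greatest : IsGreatest (InS x y) (x ⇒ y)
  greatest = ⇒-greatest-S x y
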